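{- Let $g\in\mathrm{PSL}_2(\mathbf{Z})$ be hyperbolic and equal to a reduced $UV$-word $U^{n_1}V^{m_1}\cdots U^{n_k}V^{m_k}$ (with $k>0$ and all $n_i,m_i>0$). Then this $UV$-word is a cyclic palindrome if and only if $g$ is ambiguous.
   Context: $U=\begin{pmatrix}1&0\\1&1\end{pmatrix}$, $V=\begin{pmatrix}1&1\\0&1\end{pmatrix}$, viewed in $\mathrm{PSL}_2(\mathbf{Z})$. An element of $\mathrm{PSL}_2(\mathbf{Z})$ is hyperbolic if it has two distinct real eigenvalues (absolute trace $>2$). A reduced $UV$-word is a cyclic palindrome if its reverse (the word read backwards, as a sequence of letters) can be cyclically rotated to obtain the original word. An element $g\in\mathrm{PSL}_2(\mathbf{Z})$ is ambiguous if the conjugacy class of $g$ in $\mathrm{PSL}_2(\mathbf{Z})$ is carried to the conjugacy class of $g^{ -1}$ in $\mathrm{PSL}_2(\mathbf{Z})$ by conjugation by an element of $\mathrm{PGL}_2(\mathbf{Z})$ of determinant $-1$. -}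

module Defs where

open import Data.Nat using (ℕ; zero; suc) renaming (_<_ to _<ℕ_)
open import Data.Integer using (ℤ; +_; -_; _+_; _-_; _*_; ∣_∣)
open import Data.List using (List; []; _∷_; _++_; reverse; drop; take; length; concatMap; replicate; foldr)
open import Data.List.Relation.Unary.All using (All)
open import Data.Product using (_×_; _,_; Σ; ∃; ∃-syntax; proj₁; proj₂)
open import Data.Sum using (_⊎_)
open import Relation.Binary.PropositionalEquality using (_≡_)

record M₂ : Set where
  constructor mat
  field
    a b c d : ℤ
open M₂ public

_·_ : M₂ → M₂ → M₂
mat a₁ b₁ c₁ d₁ · mat a₂ b₂ c₂ d₂ =
  mat (a₁ * a₂ + b₁ * c₂) (a₁ * b₂ + b₁ * d₂)
      (c₁ * a₂ + d₁ * c₂) (c₁ * b₂ + d₁ * d₂)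

det : M₂ → ℤ
det (mat a b c d) = a * d - b * c

tr : M₂ → ℤ
tr (mat a b c d) = a + d

neg : M₂ → M₂
neg (mat a b c d) = mat (- a) (- b) (- c) (- d)

I₂ : M₂
I₂ = mat (+ 1) (+ 0) (+ 0) (+ 1)

-- Inverse of an integer matrix of determinant ±1:
-- M⁻¹ = det(M)⁻¹ · adj(M) = det(M) · adj(M)  (since det(M)⁻¹ = det(M) when det(M) = ±1).
inv : M₂ → M₂
inv m@(mat a b c d) = let δ = det m in mat (δ * d) (δ * (- b)) (δ * (- c)) (δ * a)

-- Equality in PSL₂(ℤ) / PGL₂(ℤ): matrices equal up to sign ±1.
_≈±_ : M₂ → M₂ → Set
m ≈± n = (m ≡ n) ⊎ (m ≡ neg n)

-- Elements of SL₂(ℤ) represent PSL₂(ℤ).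
SL : M₂ → Set
SL m = det m ≡ + 1

Hyperbolic : M₂ → Set
Hyperbolic m = 2 <ℕ ∣ tr m ∣

ConjPSL : M₂ → M₂ → Set
ConjPSL g h = ∃[ P ] (SL P × ((P · g) · inv P) ≈± h)

Ambiguous : M₂ → Set
Ambiguous g = ∃[ Q ] ((det Q ≡ - (+ 1)) × ConjPSL ((Q · g) · inv Q) (inv g))

data Letter : Set where
  U V : Letter

letterMat : Letter → M₂
letterMat U = mat (+ 1) (+ 0) (+ 1) (+ 1)
letterMat V = mat (+ 1) (+ 1) (+ 0) (+ 1)

evalWord : List Letter → M₂
evalWord = foldr (λ l m → letterMat l · m) I₂

-- The reduced UV-word U^{n₁} V^{m₁} ⋯ U^{n_k} V^{m_k} given by its exponent list
-- ((n₁ , m₁) ∷ ⋯ ∷ (n_k , m_k)), as a sequence of letters.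
UVword : List (ℕ × ℕ) → List Letter
UVword = concatMap (λ p → replicate (proj₁ p) U ++ replicate (proj₂ p) V)

ValidExps : List (ℕ × ℕ) → Set
ValidExps es = (0 <ℕ length es) × All (λ p → (0 <ℕ proj₁ p) × (0 <ℕ proj₂ p)) es

rotate : {A : Set} → ℕ → List A → List A
rotate i xs = drop i xs ++ take i xs

CyclicPalindrome : List Letter → Set
CyclicPalindrome w = ∃[ i ] (rotate i (reverse w) ≡ w)

-- W = evalWord w and R = evalWord (reverse w) lie in SL₂(ℤ), R is the antitranspose of W (the
-- antitranspose reverses products and fixes U and V), and conjugation by J = diag(1, −1) sends R to W⁻¹.
-- If reverse w = u v and w = v u, then J · evalWord u has determinant −1 and conjugates W to W⁻¹.
--
-- Conversely, hyperbolicity makes W and R positive, and an ambiguity of g yields M ∈ SL₂(ℤ) with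
-- M W M⁻¹ = ±R; the sign is + since conjugation preserves the trace. Replacing M by R^k M W^j makes every
-- row and column of M sign-coherent, because the orbit of a vector under a positive matrix of
-- determinant 1 cannot stay in the mixed-sign quadrants; with determinant 1 this forces ±M ≥ 0. The
-- nonnegative matrices of determinant 1 form the free monoid on U and V, so ±M is the matrix of a word q
-- with q w = (reverse w) q, and then w is a rotation of reverse w.

module Submission where

open import Defs
open import Data.Nat using (ℕ)
open import Data.List using (List)
open import Data.Product using (_×_)
open import Function.Bundles using (_⇔_; mk⇔)

module Arithmetic where
  open import Data.Nat using (suc; _+_; _*_; _<_; z<s)
  open import Data.Nat.Properties using (+-cancelˡ-≡; +-comm; m+n≡0⇒m≡0; m<m+n; module ≤-Reasoning)
  open import Data.Nat.Tactic.RingSolver using (solve)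
  open import Data.List using (_∷_; [])
  open import Relation.Binary.PropositionalEquality using (_≡_; module ≡-Reasoning)

  m+n+o≡n⇒m≡0 : ∀ m n o → m + n + o ≡ n → m ≡ 0
  m+n+o≡n⇒m≡0 m n o eq = m+n≡0⇒m≡0 m (+-cancelˡ-≡ n (m + o) 0 (begin
    n + (m + o)      ≡⟨ solve (m ∷ n ∷ o ∷ []) ⟩
    m + n + o        ≡⟨ eq ⟩
    n                ≡⟨ +-comm 0 n ⟩
    n + 0            ∎))
    where open ≡-Reasoning

  sum<weighted-sum : ∀ a b c d m n → suc m + suc n < (suc a + suc b) * suc m + (suc c + suc d) * suc n
  sum<weighted-sum a b c d m n = begin-strict
    suc m + suc n                                                <⟨ m<m+n _ z<s ⟩
    suc m + suc n + (suc m + suc n + (a + b) * suc m + (c + d) * suc n)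
                                                                 ≡⟨ solve (a ∷ b ∷ c ∷ d ∷ m ∷ n ∷ []) ⟩
    (suc a + suc b) * suc m + (suc c + suc d) * suc n            ∎
    where open ≤-Reasoning

module Rotations {A : Set} where
  open import Data.Nat using (_<_; s≤s)
  open import Data.Nat.Induction using (<-wellFounded)
  open import Induction.WellFounded using (Acc; acc)
  open import Data.List using ([]; _∷_; _++_; length; take; drop)
  open import Data.List.Properties using (++-assoc; ++-cancelˡ; ++-identityʳ-unique; length-++-≤ʳ; ∷-injective)
  open import Data.Product using (_,_; ∃-syntax)
  open import Data.Sum using (_⊎_; inj₁; inj₂)
  open import Relation.Binary.PropositionalEquality using (_≡_; refl; sym; trans; cong; cong₂)

  drop-length-++ : ∀ (xs ys : List A) → drop (length xs) (xs ++ ys) ≡ ys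
  drop-length-++ [] ys = refl
  drop-length-++ (x ∷ xs) ys = drop-length-++ xs ys

  take-length-++ : ∀ (xs ys : List A) → take (length xs) (xs ++ ys) ≡ xs
  take-length-++ [] ys = refl
  take-length-++ (x ∷ xs) ys = cong (x ∷_) (take-length-++ xs ys)

  rotate-length : ∀ (xs ys : List A) → rotate (length xs) (xs ++ ys) ≡ ys ++ xs
  rotate-length xs ys = cong₂ _++_ (drop-length-++ xs ys) (take-length-++ xs ys)

  ++-split : ∀ (xs ys zs ws : List A) → xs ++ ys ≡ zs ++ ws →
    (∃[ t ] zs ≡ xs ++ t × ys ≡ t ++ ws) ⊎ (∃[ t ] xs ≡ zs ++ t × ws ≡ t ++ ys)
  ++-split [] ys zs ws eq = inj₁ (zs , refl , eq)
  ++-split (x ∷ xs) ys [] ws eq = inj₂ (x ∷ xs , refl , sym eq)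
  ++-split (x ∷ xs) ys (z ∷ zs) ws eq with ∷-injective eq
  ... | refl , eq′ with ++-split xs ys zs ws eq′
  ... | inj₁ (t , zs≡xs++t , ys≡t++ws) = inj₁ (t , cong (x ∷_) zs≡xs++t , ys≡t++ws)
  ... | inj₂ (t , xs≡zs++t , ws≡t++ys) = inj₂ (t , cong (x ∷_) xs≡zs++t , ws≡t++ys)

  conjugate⇒rotation : ∀ (q w r : List A) → q ++ w ≡ r ++ q → ∃[ i ] rotate i r ≡ w
  conjugate⇒rotation q w r = go q w r (<-wellFounded (length q))
    where
    go : ∀ q w r → Acc _<_ (length q) → q ++ w ≡ r ++ q → ∃[ i ] rotate i r ≡ w
    go q w r (acc shorter) eq with ++-split q w r q eq
    ... | inj₁ (t , refl , w≡t++q) = length q , trans (rotate-length q t) (sym w≡t++q)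
    ... | inj₂ (t , refl , _) with r
    ...   | [] = 0 , sym (++-identityʳ-unique t (sym eq))
    ...   | y ∷ r′ = go t w (y ∷ r′) (shorter (s≤s (length-++-≤ʳ t {r′})))
                        (++-cancelˡ (y ∷ r′) (t ++ w) (y ∷ r′ ++ t) (trans (sym (++-assoc (y ∷ r′) t w)) eq))

module Matrices where
  open import Level using (0ℓ)
  open import Data.Integer using (+_; -_; _+_; _-_; _*_)
  import Data.Integer.Properties as ℤ
  open import Data.Integer.Tactic.RingSolver using (solve-∀)
  open import Data.Sum using (inj₁; inj₂)
  open import Data.List using ([]; _∷_; _++_; [_]; reverse)
  open import Data.List.Properties using (unfold-reverse)
  open import Relation.Binary.PropositionalEquality using (_≡_; refl; sym; trans; cong; cong₂; module ≡-Reasoning)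
  open import Relation.Binary.Bundles using (Setoid)

  mat-cong : ∀ {a b c d a′ b′ c′ d′} → a ≡ a′ → b ≡ b′ → c ≡ c′ → d ≡ d′ →
             mat a b c d ≡ mat a′ b′ c′ d′
  mat-cong refl refl refl refl = refl

  ·-assoc : ∀ A B C → (A · B) · C ≡ A · (B · C)
  ·-assoc (mat a b c d) (mat e f g h) (mat i j k l) =
    mat-cong (entry a b e f g h i k) (entry a b e f g h j l)
             (entry c d e f g h i k) (entry c d e f g h j l)
    where
    entry : ∀ a b e f g h i k →
            (a * e + b * g) * i + (a * f + b * h) * k ≡ a * (e * i + f * k) + b * (g * i + h * k)
    entry = solve-∀

  ·-identityˡ : ∀ A → I₂ · A ≡ A
  ·-identityˡ (mat a b c d) = mat-cong (first a c) (first b d) (second a c) (second b d)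
    where
    first : ∀ x y → + 1 * x + + 0 * y ≡ x
    first = solve-∀
    second : ∀ x y → + 0 * x + + 1 * y ≡ y
    second = solve-∀

  ·-identityʳ : ∀ A → A · I₂ ≡ A
  ·-identityʳ (mat a b c d) = mat-cong (first a b) (second a b) (first c d) (second c d)
    where
    first : ∀ x y → x * + 1 + y * + 0 ≡ x
    first = solve-∀
    second : ∀ x y → x * + 0 + y * + 1 ≡ y
    second = solve-∀

  det-· : ∀ A B → det (A · B) ≡ det A * det B
  det-· (mat a b c d) (mat e f g h) = identity a b c d e f g h
    where
    identity : ∀ a b c d e f g h →
      (a * e + b * g) * (c * f + d * h) - (a * f + b * h) * (c * e + d * g) ≡ (a * d - b * c) * (e * h - f * g)
    identity = solve-∀

  inv-· : ∀ A B → inv (A · B) ≡ inv B · inv A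
  inv-· (mat a b c d) (mat e f g h) =
    mat-cong (entry₁ a b c d e f g h) (entry₂ a b c d e f g h) (entry₃ a b c d e f g h) (entry₄ a b c d e f g h)
    where
    entry₁ : ∀ a b c d e f g h → ((a * e + b * g) * (c * f + d * h) - (a * f + b * h) * (c * e + d * g)) * (c * f + d * h)
       ≡ ((e * h - f * g) * h) * ((a * d - b * c) * d) + ((e * h - f * g) * (- f)) * ((a * d - b * c) * (- c))
    entry₁ = solve-∀
    entry₂ : ∀ a b c d e f g h → ((a * e + b * g) * (c * f + d * h) - (a * f + b * h) * (c * e + d * g)) * (- (a * f + b * h))
       ≡ ((e * h - f * g) * h) * ((a * d - b * c) * (- b)) + ((e * h - f * g) * (- f)) * ((a * d - b * c) * a)
    entry₂ = solve-∀
    entry₃ : ∀ a b c d e f g h → ((a * e + b * g) * (c * f + d * h) - (a * f + b * h) * (c * e + d * g)) * (- (c * e + d * g))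
       ≡ ((e * h - f * g) * (- g)) * ((a * d - b * c) * d) + ((e * h - f * g) * e) * ((a * d - b * c) * (- c))
    entry₃ = solve-∀
    entry₄ : ∀ a b c d e f g h → ((a * e + b * g) * (c * f + d * h) - (a * f + b * h) * (c * e + d * g)) * (a * e + b * g)
       ≡ ((e * h - f * g) * (- g)) * ((a * d - b * c) * (- b)) + ((e * h - f * g) * e) * ((a * d - b * c) * a)
    entry₄ = solve-∀

  ·-inverseʳ : ∀ A → SL A → A · inv A ≡ I₂
  ·-inverseʳ (mat a b c d) det≡1 =
    mat-cong (trans (entry₁ a b c d) det²≡1) (entry₂ a b c d) (entry₃ a b c d) (trans (entry₄ a b c d) det²≡1)
    where
    det²≡1 : (a * d - b * c) * (a * d - b * c) ≡ + 1
    det²≡1 = cong₂ _*_ det≡1 det≡1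
    entry₁ : ∀ a b c d → a * ((a * d - b * c) * d) + b * ((a * d - b * c) * (- c)) ≡ (a * d - b * c) * (a * d - b * c)
    entry₁ = solve-∀
    entry₂ : ∀ a b c d → a * ((a * d - b * c) * (- b)) + b * ((a * d - b * c) * a) ≡ + 0
    entry₂ = solve-∀
    entry₃ : ∀ a b c d → c * ((a * d - b * c) * d) + d * ((a * d - b * c) * (- c)) ≡ + 0
    entry₃ = solve-∀
    entry₄ : ∀ a b c d → c * ((a * d - b * c) * (- b)) + d * ((a * d - b * c) * a) ≡ (a * d - b * c) * (a * d - b * c)
    entry₄ = solve-∀

  ·-inverseˡ : ∀ A → SL A → inv A · A ≡ I₂
  ·-inverseˡ (mat a b c d) det≡1 =
    mat-cong (trans (entry₁ a b c d) det²≡1) (entry₂ a b c d) (entry₃ a b c d) (trans (entry₄ a b c d) det²≡1)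
    where
    det²≡1 : (a * d - b * c) * (a * d - b * c) ≡ + 1
    det²≡1 = cong₂ _*_ det≡1 det≡1
    entry₁ : ∀ a b c d → ((a * d - b * c) * d) * a + ((a * d - b * c) * (- b)) * c ≡ (a * d - b * c) * (a * d - b * c)
    entry₁ = solve-∀
    entry₂ : ∀ a b c d → ((a * d - b * c) * d) * b + ((a * d - b * c) * (- b)) * d ≡ + 0
    entry₂ = solve-∀
    entry₃ : ∀ a b c d → ((a * d - b * c) * (- c)) * a + ((a * d - b * c) * a) * c ≡ + 0
    entry₃ = solve-∀
    entry₄ : ∀ a b c d → ((a * d - b * c) * (- c)) * b + ((a * d - b * c) * a) * d ≡ (a * d - b * c) * (a * d - b * c)
    entry₄ = solve-∀

  neg-·ˡ : ∀ A B → neg A · B ≡ neg (A · B)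
  neg-·ˡ (mat a b c d) (mat e f g h) = mat-cong (entry a b e g) (entry a b f h) (entry c d e g) (entry c d f h)
    where
    entry : ∀ a b e g → (- a) * e + (- b) * g ≡ - (a * e + b * g)
    entry = solve-∀

  neg-·ʳ : ∀ A B → A · neg B ≡ neg (A · B)
  neg-·ʳ (mat a b c d) (mat e f g h) = mat-cong (entry a b e g) (entry a b f h) (entry c d e g) (entry c d f h)
    where
    entry : ∀ a b e g → a * (- e) + b * (- g) ≡ - (a * e + b * g)
    entry = solve-∀

  neg-involutive : ∀ A → neg (neg A) ≡ A
  neg-involutive (mat a b c d) = mat-cong (ℤ.neg-involutive a) (ℤ.neg-involutive b) (ℤ.neg-involutive c) (ℤ.neg-involutive d)

  det-neg : ∀ A → det (neg A) ≡ det A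
  det-neg (mat a b c d) = identity a b c d
    where
    identity : ∀ a b c d → (- a) * (- d) - (- b) * (- c) ≡ a * d - b * c
    identity = solve-∀

  inv-neg : ∀ A → inv (neg A) ≡ neg (inv A)
  inv-neg (mat a b c d) = mat-cong (entry a b c d d) (entry′ a b c d b) (entry′ a b c d c) (entry a b c d a)
    where
    entry : ∀ a b c d x → ((- a) * (- d) - (- b) * (- c)) * (- x) ≡ - ((a * d - b * c) * x)
    entry = solve-∀
    entry′ : ∀ a b c d x → ((- a) * (- d) - (- b) * (- c)) * (- (- x)) ≡ - ((a * d - b * c) * (- x))
    entry′ = solve-∀

  tr-neg : ∀ A → tr (neg A) ≡ - tr A
  tr-neg (mat a b c d) = identity a d
    where
    identity : ∀ a d → (- a) + (- d) ≡ - (a + d)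
    identity = solve-∀

  ≈±-refl : ∀ {A} → A ≈± A
  ≈±-refl = inj₁ refl

  ≈±-sym : ∀ {A B} → A ≈± B → B ≈± A
  ≈±-sym (inj₁ A≡B) = inj₁ (sym A≡B)
  ≈±-sym {B = B} (inj₂ A≡-B) = inj₂ (trans (sym (neg-involutive B)) (cong neg (sym A≡-B)))

  ≈±-trans : ∀ {A B C} → A ≈± B → B ≈± C → A ≈± C
  ≈±-trans (inj₁ A≡B) (inj₁ B≡C) = inj₁ (trans A≡B B≡C)
  ≈±-trans (inj₁ A≡B) (inj₂ B≡-C) = inj₂ (trans A≡B B≡-C)
  ≈±-trans (inj₂ A≡-B) (inj₁ B≡C) = inj₂ (trans A≡-B (cong neg B≡C))
  ≈±-trans {C = C} (inj₂ A≡-B) (inj₂ B≡-C) = inj₁ (trans A≡-B (trans (cong neg B≡-C) (neg-involutive C)))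

  ≈±-setoid : Setoid 0ℓ 0ℓ
  ≈±-setoid = record
    { Carrier = M₂
    ; _≈_ = _≈±_
    ; isEquivalence = record { refl = ≈±-refl ; sym = ≈±-sym ; trans = ≈±-trans }
    }

  inv-cong : ∀ {A B} → A ≈± B → inv A ≈± inv B
  inv-cong (inj₁ A≡B) = inj₁ (cong inv A≡B)
  inv-cong {B = B} (inj₂ A≡-B) = inj₂ (trans (cong inv A≡-B) (inv-neg B))

  conj : M₂ → M₂ → M₂
  conj P X = (P · X) · inv P

  conj-identity : ∀ X → conj I₂ X ≡ X
  conj-identity X = trans (·-identityʳ (I₂ · X)) (·-identityˡ X)

  conj-· : ∀ P Q X → conj (P · Q) X ≡ conj P (conj Q X)
  conj-· P Q X = begin
    ((P · Q) · X) · inv (P · Q)         ≡⟨ cong₂ _·_ (·-assoc P Q X) (inv-· P Q) ⟩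
    (P · (Q · X)) · (inv Q · inv P)     ≡⟨ ·-assoc (P · (Q · X)) (inv Q) (inv P) ⟨
    ((P · (Q · X)) · inv Q) · inv P     ≡⟨ cong (_· inv P) (·-assoc P (Q · X) (inv Q)) ⟩
    (P · ((Q · X) · inv Q)) · inv P     ∎
    where open ≡-Reasoning

  conj-cong : ∀ P {X Y} → X ≈± Y → conj P X ≈± conj P Y
  conj-cong P (inj₁ X≡Y) = inj₁ (cong (conj P) X≡Y)
  conj-cong P {X} {Y} (inj₂ X≡-Y) = inj₂ (begin
    (P · X) · inv P         ≡⟨ cong (λ Z → (P · Z) · inv P) X≡-Y ⟩
    (P · neg Y) · inv P     ≡⟨ cong (_· inv P) (neg-·ʳ P Y) ⟩
    neg (P · Y) · inv P     ≡⟨ neg-·ˡ (P · Y) (inv P) ⟩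
    neg (conj P Y)          ∎)
    where open ≡-Reasoning

  conj≡⇒intertwines : ∀ P X Y → SL P → conj P X ≡ Y → P · X ≡ Y · P
  conj≡⇒intertwines P X Y detP≡1 PXP⁻¹≡Y = begin
    P · X                        ≡⟨ ·-identityʳ (P · X) ⟨
    (P · X) · I₂                 ≡⟨ cong ((P · X) ·_) (·-inverseˡ P detP≡1) ⟨
    (P · X) · (inv P · P)        ≡⟨ ·-assoc (P · X) (inv P) P ⟨
    conj P X · P                 ≡⟨ cong (_· P) PXP⁻¹≡Y ⟩
    Y · P                        ∎
    where open ≡-Reasoning

  intertwines⇒conj≡ : ∀ P X Y → SL P → P · X ≡ Y · P → conj P X ≡ Y
  intertwines⇒conj≡ P X Y detP≡1 PX≡YP = begin
    (P · X) · inv P              ≡⟨ cong (_· inv P) PX≡YP ⟩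
    (Y · P) · inv P              ≡⟨ ·-assoc Y P (inv P) ⟩
    Y · (P · inv P)              ≡⟨ cong (Y ·_) (·-inverseʳ P detP≡1) ⟩
    Y · I₂                       ≡⟨ ·-identityʳ Y ⟩
    Y                            ∎
    where open ≡-Reasoning

  tr-conj : ∀ P X → SL P → tr (conj P X) ≡ tr X
  tr-conj (mat a b c d) (mat e f g h) detP≡1 =
    trans (identity a b c d e f g h) (trans (cong (λ δ → δ * δ * (e + h)) detP≡1) (ℤ.*-identityˡ (e + h)))
    where
    identity : ∀ a b c d e f g h →
      ((a * e + b * g) * ((a * d - b * c) * d) + (a * f + b * h) * ((a * d - b * c) * (- c)))
        + ((c * e + d * g) * ((a * d - b * c) * (- b)) + (c * f + d * h) * ((a * d - b * c) * a))
      ≡ (a * d - b * c) * (a * d - b * c) * (e + h)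
    identity = solve-∀

  J : M₂
  J = mat (+ 1) (+ 0) (+ 0) (- + 1)

  conj-J-involutive : ∀ X → conj J (conj J X) ≡ X
  conj-J-involutive X = trans (sym (conj-· J J X)) (conj-identity X)

  antitranspose : M₂ → M₂
  antitranspose (mat a b c d) = mat d b c a

  antitranspose-· : ∀ A B → antitranspose (A · B) ≡ antitranspose B · antitranspose A
  antitranspose-· (mat a b c d) (mat e f g h) =
    mat-cong (entry c d f h) (entry a b f h) (entry c d e g) (entry a b e g)
    where
    entry : ∀ a b e g → a * e + b * g ≡ g * b + e * a
    entry = solve-∀

  inv≡conj-J-antitranspose : ∀ X → SL X → inv X ≡ conj J (antitranspose X)
  inv≡conj-J-antitranspose (mat a b c d) detX≡1 =
    mat-cong (trans (cong (_* d) detX≡1) (entry₁ a b c d)) (trans (cong (_* (- b)) detX≡1) (entry₂ a b c d))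
             (trans (cong (_* (- c)) detX≡1) (entry₃ a b c d)) (trans (cong (_* a) detX≡1) (entry₄ a b c d))
    where
    entry₁ : ∀ a b c d → + 1 * d ≡ (+ 1 * d + + 0 * c) * + 1 + (+ 1 * b + + 0 * a) * + 0
    entry₁ = solve-∀
    entry₂ : ∀ a b c d → + 1 * (- b) ≡ (+ 1 * d + + 0 * c) * + 0 + (+ 1 * b + + 0 * a) * (- + 1)
    entry₂ = solve-∀
    entry₃ : ∀ a b c d → + 1 * (- c) ≡ (+ 0 * d + (- + 1) * c) * + 1 + (+ 0 * b + (- + 1) * a) * + 0
    entry₃ = solve-∀
    entry₄ : ∀ a b c d → + 1 * a ≡ (+ 0 * d + (- + 1) * c) * + 0 + (+ 0 * b + (- + 1) * a) * (- + 1)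
    entry₄ = solve-∀

  infix 30 _ᵀ

  _ᵀ : M₂ → M₂
  mat a b c d ᵀ = mat a c b d

  ᵀ-· : ∀ A B → (A · B) ᵀ ≡ B ᵀ · A ᵀ
  ᵀ-· (mat a b c d) (mat e f g h) =
    mat-cong (entry a b e g) (entry c d e g) (entry a b f h) (entry c d f h)
    where
    entry : ∀ a b e g → a * e + b * g ≡ e * a + g * b
    entry = solve-∀

  SL-· : ∀ A B → SL A → SL B → SL (A · B)
  SL-· A B detA≡1 detB≡1 = trans (det-· A B) (cong₂ _*_ detA≡1 detB≡1)

  SL-ᵀ : ∀ A → SL A → SL (A ᵀ)
  SL-ᵀ (mat a b c d) = trans (cong (λ x → a * d - x) (ℤ.*-comm c b))

  ≈±-SL : ∀ {A B} → A ≈± B → SL A → SL B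
  ≈±-SL (inj₁ refl) det≡1 = det≡1
  ≈±-SL {A} {B} (inj₂ A≡-B) det≡1 = trans (sym (det-neg B)) (trans (cong det (sym A≡-B)) det≡1)

  evalWord-++ : ∀ u v → evalWord (u ++ v) ≡ evalWord u · evalWord v
  evalWord-++ [] v = sym (·-identityˡ (evalWord v))
  evalWord-++ (l ∷ u) v = trans (cong (letterMat l ·_) (evalWord-++ u v)) (sym (·-assoc (letterMat l) (evalWord u) (evalWord v)))

  letterMat-SL : ∀ l → SL (letterMat l)
  letterMat-SL U = refl
  letterMat-SL V = refl

  evalWord-SL : ∀ w → SL (evalWord w)
  evalWord-SL [] = refl
  evalWord-SL (l ∷ w) = trans (det-· (letterMat l) (evalWord w)) (cong₂ _*_ (letterMat-SL l) (evalWord-SL w))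

  antitranspose-letterMat : ∀ l → antitranspose (letterMat l) ≡ letterMat l
  antitranspose-letterMat U = refl
  antitranspose-letterMat V = refl

  evalWord-reverse : ∀ w → evalWord (reverse w) ≡ antitranspose (evalWord w)
  evalWord-reverse [] = refl
  evalWord-reverse (l ∷ w) = begin
    evalWord (reverse (l ∷ w))                          ≡⟨ cong evalWord (unfold-reverse l w) ⟩
    evalWord (reverse w ++ [ l ])                       ≡⟨ evalWord-++ (reverse w) [ l ] ⟩
    evalWord (reverse w) · (letterMat l · I₂)           ≡⟨ cong₂ _·_ (evalWord-reverse w) (·-identityʳ (letterMat l)) ⟩
    antitranspose (evalWord w) · letterMat l            ≡⟨ cong (antitranspose (evalWord w) ·_) (antitranspose-letterMat l) ⟨
    antitranspose (evalWord w) · antitranspose (letterMat l) ≡⟨ antitranspose-· (letterMat l) (evalWord w) ⟨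
    antitranspose (evalWord (l ∷ w))                    ∎
    where open ≡-Reasoning

module NonnegativeMatrices where
  open Arithmetic
  open Matrices
  open import Data.Nat using (ℕ; zero; suc; _+_; _*_; _∸_; _<_; _≤_; _≤?_; z<s)
  open import Data.Nat.Properties
    using (+-cancelˡ-≡; +-cancelʳ-≡; +-cancelˡ-≤; m+n≡0⇒m≡0; m+n≡0⇒n≡0; n≤0⇒n≡0; ≰⇒>; <⇒≤; m<m+n; n<1+n;
           <-irrefl; +-comm; *-comm; *-zeroʳ; *-mono-≤; m*n≡1⇒m≡1; m*n≡1⇒n≡1; m+[n∸m]≡n; m∸n+n≡m; module ≤-Reasoning)
  open import Data.Nat.Tactic.RingSolver using (solve)
  open import Data.Nat.Induction using (<-wellFounded)
  open import Induction.WellFounded using (Acc; acc)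
  import Data.Integer as ℤ
  import Data.Integer.Properties as ℤ
  open import Data.Integer using (+_)
  open import Data.Integer.Tactic.RingSolver using (solve-∀)
  open import Data.List using ([]; _∷_; foldr)
  open import Data.Product using (_,_; ∃-syntax; ∃₂)
  open import Data.Sum using (_⊎_; inj₁; inj₂)
  open import Data.Empty using (⊥; ⊥-elim)
  open import Relation.Nullary using (yes; no)
  open import Relation.Binary.PropositionalEquality using (_≡_; _≢_; refl; sym; trans; cong; cong₂; subst; module ≡-Reasoning)

  record Mℕ : Set where
    constructor matℕ
    field
      p q r s : ℕ

  toℤ : Mℕ → M₂
  toℤ (matℕ p q r s) = mat (+ p) (+ q) (+ r) (+ s)

  toℤ-injective : ∀ {X Y} → toℤ X ≡ toℤ Y → X ≡ Y
  toℤ-injective {matℕ p q r s} refl = refl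

  Unimodular : Mℕ → Set
  Unimodular (matℕ p q r s) = p * s ≡ 1 + q * r

  SL-toℤ⇒Unimodular : ∀ X → SL (toℤ X) → Unimodular X
  SL-toℤ⇒Unimodular (matℕ p q r s) det≡1 = ℤ.+-injective (begin
    + (p * s)                          ≡⟨ ℤ.pos-* p s ⟩
    + p ℤ.* + s                        ≡⟨ shift (+ p ℤ.* + s) (+ q ℤ.* + r) ⟩
    (+ p ℤ.* + s ℤ.- + q ℤ.* + r) ℤ.+ + q ℤ.* + r ≡⟨ cong₂ ℤ._+_ det≡1 (sym (ℤ.pos-* q r)) ⟩
    + (1 + q * r)                      ∎)
    where
    open ≡-Reasoning
    shift : ∀ x y → x ≡ (x ℤ.- y) ℤ.+ y
    shift = solve-∀

  Unimodular⇒SL-toℤ : ∀ X → Unimodular X → SL (toℤ X)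
  Unimodular⇒SL-toℤ (matℕ p q r s) ps≡1+qr = begin
    + p ℤ.* + s ℤ.- + q ℤ.* + r        ≡⟨ cong₂ ℤ._-_ (sym (ℤ.pos-* p s)) (sym (ℤ.pos-* q r)) ⟩
    + (p * s) ℤ.- + (q * r)            ≡⟨ cong (λ n → + n ℤ.- + (q * r)) ps≡1+qr ⟩
    + 1 ℤ.+ + (q * r) ℤ.- + (q * r)    ≡⟨ cancel (+ 1) (+ (q * r)) ⟩
    + 1                                ∎
    where
    open ≡-Reasoning
    cancel : ∀ x y → x ℤ.+ y ℤ.- y ≡ x
    cancel = solve-∀

  Iℕ : Mℕ
  Iℕ = matℕ 1 0 0 1

  lmul : Letter → Mℕ → Mℕ
  lmul U (matℕ p q r s) = matℕ p q (p + r) (q + s)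
  lmul V (matℕ p q r s) = matℕ (p + r) (q + s) r s

  toℤ-lmul : ∀ l X → toℤ (lmul l X) ≡ letterMat l · toℤ X
  toℤ-lmul U (matℕ p q r s) = mat-cong (sym (first (+ p) (+ r))) (sym (first (+ q) (+ s)))
                                       (sym (sum (+ p) (+ r))) (sym (sum (+ q) (+ s)))
    where
    first : ∀ x y → + 1 ℤ.* x ℤ.+ + 0 ℤ.* y ≡ x
    first = solve-∀
    sum : ∀ x y → + 1 ℤ.* x ℤ.+ + 1 ℤ.* y ≡ x ℤ.+ y
    sum = solve-∀
  toℤ-lmul V (matℕ p q r s) = mat-cong (sym (sum (+ p) (+ r))) (sym (sum (+ q) (+ s)))
                                       (sym (second (+ p) (+ r))) (sym (second (+ q) (+ s)))
    where
    second : ∀ x y → + 0 ℤ.* x ℤ.+ + 1 ℤ.* y ≡ y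
    second = solve-∀
    sum : ∀ x y → + 1 ℤ.* x ℤ.+ + 1 ℤ.* y ≡ x ℤ.+ y
    sum = solve-∀

  evalℕ : List Letter → Mℕ
  evalℕ = foldr lmul Iℕ

  evalWord≡toℤ-evalℕ : ∀ w → evalWord w ≡ toℤ (evalℕ w)
  evalWord≡toℤ-evalℕ [] = refl
  evalWord≡toℤ-evalℕ (l ∷ w) = trans (cong (letterMat l ·_) (evalWord≡toℤ-evalℕ w)) (sym (toℤ-lmul l (evalℕ w)))

  evalℕ-unimodular : ∀ w → Unimodular (evalℕ w)
  evalℕ-unimodular w = SL-toℤ⇒Unimodular (evalℕ w) (subst SL (evalWord≡toℤ-evalℕ w) (evalWord-SL w))

  lmul-unimodular⁻¹ : ∀ l X → Unimodular (lmul l X) → Unimodular X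
  lmul-unimodular⁻¹ l X unimodular = SL-toℤ⇒Unimodular X (begin
    det (toℤ X)                          ≡⟨ ℤ.*-identityˡ (det (toℤ X)) ⟨
    + 1 ℤ.* det (toℤ X)                  ≡⟨ cong (ℤ._* det (toℤ X)) (letterMat-SL l) ⟨
    det (letterMat l) ℤ.* det (toℤ X)    ≡⟨ det-· (letterMat l) (toℤ X) ⟨
    det (letterMat l · toℤ X)            ≡⟨ cong det (toℤ-lmul l X) ⟨
    det (toℤ (lmul l X))                 ≡⟨ Unimodular⇒SL-toℤ (lmul l X) unimodular ⟩
    + 1                                  ∎)
    where open ≡-Reasoning

  Iℕ≢lmul : ∀ l X → Iℕ ≢ lmul l X
  Iℕ≢lmul U (matℕ p q r s) eq with cong Mℕ.p eq | cong Mℕ.r eq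
  ... | refl | ()
  Iℕ≢lmul V (matℕ p q r s) eq with cong Mℕ.s eq | m+n≡0⇒n≡0 q (sym (cong Mℕ.q eq))
  ... | refl | ()

  lmul-injective : ∀ l {X Y} → lmul l X ≡ lmul l Y → X ≡ Y
  lmul-injective U {matℕ p q r s} {matℕ p′ q′ r′ s′} eq with cong Mℕ.p eq | cong Mℕ.q eq
  ... | refl | refl with +-cancelˡ-≡ p r r′ (cong Mℕ.r eq) | +-cancelˡ-≡ q s s′ (cong Mℕ.s eq)
  ... | refl | refl = refl
  lmul-injective V {matℕ p q r s} {matℕ p′ q′ r′ s′} eq with cong Mℕ.r eq | cong Mℕ.s eq
  ... | refl | refl with +-cancelʳ-≡ r p p′ (cong Mℕ.p eq) | +-cancelʳ-≡ s q q′ (cong Mℕ.q eq)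
  ... | refl | refl = refl

  -- Comparing entries, U X = V Y forces the first row of Y to vanish.
  lmulU≢lmulV : ∀ X Y → Unimodular Y → lmul U X ≢ lmul V Y
  lmulU≢lmulV (matℕ p q r s) (matℕ p′ q′ r′ s′) unimodular eq with cong Mℕ.p eq | cong Mℕ.q eq
  ... | refl | refl with m+n+o≡n⇒m≡0 p′ r′ r (cong Mℕ.r eq) | m+n+o≡n⇒m≡0 q′ s′ s (cong Mℕ.s eq)
  ... | refl | refl with unimodular
  ... | ()

  evalℕ-injective : ∀ u v → evalℕ u ≡ evalℕ v → u ≡ v
  evalℕ-injective [] [] _ = refl
  evalℕ-injective [] (l ∷ v) eq = ⊥-elim (Iℕ≢lmul l (evalℕ v) eq)
  evalℕ-injective (l ∷ u) [] eq = ⊥-elim (Iℕ≢lmul l (evalℕ u) (sym eq))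
  evalℕ-injective (U ∷ u) (V ∷ v) eq = ⊥-elim (lmulU≢lmulV (evalℕ u) (evalℕ v) (evalℕ-unimodular v) eq)
  evalℕ-injective (V ∷ u) (U ∷ v) eq = ⊥-elim (lmulU≢lmulV (evalℕ v) (evalℕ u) (evalℕ-unimodular u) (sym eq))
  evalℕ-injective (U ∷ u) (U ∷ v) eq = cong (U ∷_) (evalℕ-injective u v (lmul-injective U eq))
  evalℕ-injective (V ∷ u) (V ∷ v) eq = cong (V ∷_) (evalℕ-injective u v (lmul-injective V eq))

  evalWord-injective : ∀ u v → evalWord u ≡ evalWord v → u ≡ v
  evalWord-injective u v eq =
    evalℕ-injective u v (toℤ-injective (trans (sym (evalWord≡toℤ-evalℕ u)) (trans eq (evalWord≡toℤ-evalℕ v))))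

  size : Mℕ → ℕ
  size (matℕ p q r s) = p + q + r + s

  size-lmul : ∀ l X → Unimodular X → size X < size (lmul l X)
  size-lmul U (matℕ (suc p) q r s) _ = begin-strict
    suc p + q + r + s                     <⟨ m<m+n _ z<s ⟩
    suc p + q + r + s + (suc p + q)       ≡⟨ solve (p ∷ q ∷ r ∷ s ∷ []) ⟩
    suc p + q + (suc p + r) + (q + s)     ∎
    where open ≤-Reasoning
  size-lmul V (matℕ p q r (suc s)) _ = begin-strict
    p + q + r + suc s                     <⟨ m<m+n _ z<s ⟩
    p + q + r + suc s + (suc s + r)       ≡⟨ solve (p ∷ q ∷ r ∷ s ∷ []) ⟩
    p + r + (q + suc s) + r + suc s       ∎
    where open ≤-Reasoning
  size-lmul U (matℕ zero q r s) ()
  size-lmul V (matℕ p q r zero) unimodular with trans (sym (*-zeroʳ p)) unimodular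
  ... | ()

  rows-≤⇒lmulU : ∀ {p q r s} → p ≤ r → q ≤ s → matℕ p q r s ≡ lmul U (matℕ p q (r ∸ p) (s ∸ q))
  rows-≤⇒lmulU {p} {q} p≤r q≤s = sym (cong₂ (matℕ p q) (m+[n∸m]≡n p≤r) (m+[n∸m]≡n q≤s))

  rows-≥⇒lmulV : ∀ {p q r s} → r ≤ p → s ≤ q → matℕ p q r s ≡ lmul V (matℕ (p ∸ r) (q ∸ s) r s)
  rows-≥⇒lmulV {r = r} {s} r≤p s≤q = sym (cong₂ (λ x y → matℕ x y r s) (m∸n+n≡m r≤p) (m∸n+n≡m s≤q))

  Unimodular-¬rows-≤> : ∀ {p q r s} → Unimodular (matℕ p q r s) → p ≤ r → s < q → ⊥
  Unimodular-¬rows-≤> {p} {q} {r} {s} unimodular p≤r s<q = <-irrefl refl (begin-strict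
    p * s          ≤⟨ *-mono-≤ p≤r (<⇒≤ s<q) ⟩
    r * q          ≡⟨ *-comm r q ⟩
    q * r          <⟨ n<1+n (q * r) ⟩
    1 + q * r      ≡⟨ unimodular ⟨
    p * s          ∎)
    where open ≤-Reasoning

  Unimodular-rows-><⇒identity : ∀ {p q r s} → Unimodular (matℕ p q r s) → r < p → q < s → matℕ p q r s ≡ Iℕ
  Unimodular-rows-><⇒identity {p} {q} {r} {s} unimodular r<p q<s
    with m+n≡0⇒m≡0 q q+r≡0 | m+n≡0⇒n≡0 q q+r≡0
    where
    q+r≡0 : q + r ≡ 0
    q+r≡0 = n≤0⇒n≡0 (+-cancelˡ-≤ (suc (q * r)) _ _ (begin
      suc (q * r) + (q + r)   ≡⟨ solve (q ∷ r ∷ []) ⟩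
      suc r * suc q           ≤⟨ *-mono-≤ r<p q<s ⟩
      p * s                   ≡⟨ unimodular ⟩
      suc (q * r)             ≡⟨ +-comm 0 (suc (q * r)) ⟩
      suc (q * r) + 0         ∎))
      where open ≤-Reasoning
  ... | refl | refl with m*n≡1⇒m≡1 p s unimodular | m*n≡1⇒n≡1 p s unimodular
  ... | refl | refl = refl

  -- Euclid's algorithm: unless X = I, one row of X dominates the other.
  Unimodular⇒identity⊎lmul : ∀ X → Unimodular X → X ≡ Iℕ ⊎ ∃₂ λ l X′ → X ≡ lmul l X′
  Unimodular⇒identity⊎lmul (matℕ p q r s) unimodular with p ≤? r | q ≤? s | s ≤? q
  ... | yes p≤r | yes q≤s | _       = inj₂ (U , _ , rows-≤⇒lmulU p≤r q≤s)
  ... | yes p≤r | no q≰s  | _       = ⊥-elim (Unimodular-¬rows-≤> unimodular p≤r (≰⇒> q≰s))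
  ... | no p≰r  | _       | yes s≤q = inj₂ (V , _ , rows-≥⇒lmulV (<⇒≤ (≰⇒> p≰r)) s≤q)
  ... | no p≰r  | _       | no s≰q  = inj₁ (Unimodular-rows-><⇒identity unimodular (≰⇒> p≰r) (≰⇒> s≰q))

  evalℕ-surjective : ∀ X → Unimodular X → ∃[ w ] evalℕ w ≡ X
  evalℕ-surjective X unimodular = go X unimodular (<-wellFounded (size X))
    where
    go : ∀ X → Unimodular X → Acc _<_ (size X) → ∃[ w ] evalℕ w ≡ X
    go X unimodular (acc smaller) with Unimodular⇒identity⊎lmul X unimodular
    ... | inj₁ refl = [] , refl
    ... | inj₂ (l , X′ , refl) with lmul-unimodular⁻¹ l X′ unimodular
    ... | unimodular′ with go X′ unimodular′ (smaller (size-lmul l X′ unimodular′))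
    ... | w , evalℕw≡X′ = l ∷ w , cong (lmul l) evalℕw≡X′

module SignCoherence where
  open Arithmetic
  open Matrices using (_ᵀ; antitranspose)
  open NonnegativeMatrices
  open import Data.Nat using (ℕ; zero; suc; _<_)
  import Data.Nat as ℕ
  open import Data.Nat.Properties using (+-suc; +-comm)
  open import Data.Nat.GeneralisedArithmetic using (iterate)
  open import Data.Nat.Induction using (<-wellFounded)
  open import Induction.WellFounded using (Acc; acc)
  open import Data.Integer using (ℤ; +_; -_; +[1+_]; -[1+_]; _+_; _-_; _*_; ∣_∣)
  open import Data.Integer.Properties using (*-identityˡ; pos-*; pos-+; neg-involutive)
  open import Data.Integer.Tactic.RingSolver using (solve-∀)
  open import Data.Bool using (Bool; true; false; T)
  open import Data.Unit using (tt)
  open import Data.Product using (_,_; proj₁; proj₂; ∃-syntax; ∃₂)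
  open import Data.Sum using (_⊎_; inj₁; inj₂)
  open import Relation.Binary.PropositionalEquality using (_≡_; refl; sym; trans; cong; cong₂; subst; subst₂)

  _⊳_ : M₂ → ℤ × ℤ → ℤ × ℤ
  mat a b c d ⊳ (x , y) = (a * x + b * y , c * x + d * y)

  coherentᵇ : ℤ → ℤ → Bool
  coherentᵇ +[1+ _ ] -[1+ _ ] = false
  coherentᵇ -[1+ _ ] +[1+ _ ] = false
  coherentᵇ _ _ = true

  SignCoherent : ℤ × ℤ → Set
  SignCoherent (x , y) = T (coherentᵇ x y)

  data Mixed : ℤ × ℤ → Set where
    +- : ∀ m n → Mixed (+[1+ m ] , -[1+ n ])
    -+ : ∀ m n → Mixed (-[1+ m ] , +[1+ n ])

  signCoherent⊎mixed : ∀ v → SignCoherent v ⊎ Mixed v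
  signCoherent⊎mixed (+[1+ m ] , -[1+ n ]) = inj₂ (+- m n)
  signCoherent⊎mixed (-[1+ m ] , +[1+ n ]) = inj₂ (-+ m n)
  signCoherent⊎mixed (+ zero , y) = inj₁ tt
  signCoherent⊎mixed (+[1+ m ] , + n) = inj₁ tt
  signCoherent⊎mixed (-[1+ m ] , + zero) = inj₁ tt
  signCoherent⊎mixed (-[1+ m ] , -[1+ n ]) = inj₁ tt

  SignCoherent-nonneg : ∀ m n → SignCoherent (+ m , + n)
  SignCoherent-nonneg zero n = tt
  SignCoherent-nonneg (suc m) n = tt

  SignCoherent-nonpos : ∀ m n → SignCoherent (- + m , - + n)
  SignCoherent-nonpos zero zero = tt
  SignCoherent-nonpos zero (suc n) = tt
  SignCoherent-nonpos (suc m) zero = tt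
  SignCoherent-nonpos (suc m) (suc n) = tt

  SignCoherent-view : ∀ v → SignCoherent v → (∃₂ λ m n → v ≡ (+ m , + n)) ⊎ (∃₂ λ m n → v ≡ (- + m , - + n))
  SignCoherent-view (+ m , + n) _ = inj₁ (m , n , refl)
  SignCoherent-view (+ zero , -[1+ n ]) _ = inj₂ (0 , suc n , refl)
  SignCoherent-view (-[1+ m ] , + zero) _ = inj₂ (suc m , 0 , refl)
  SignCoherent-view (-[1+ m ] , -[1+ n ]) _ = inj₂ (suc m , suc n , refl)

  SignCoherent-neg : ∀ {x y} → SignCoherent (x , y) → SignCoherent (- x , - y)
  SignCoherent-neg {x} {y} coherent with SignCoherent-view (x , y) coherent
  ... | inj₁ (m , n , refl) = SignCoherent-nonpos m n
  ... | inj₂ (m , n , refl) = subst SignCoherent (sym (cong₂ _,_ (neg-involutive (+ m)) (neg-involutive (+ n)))) (SignCoherent-nonneg m n)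

  toℤ-⊳-nonneg : ∀ X m n → toℤ X ⊳ (+ m , + n) ≡ (+ (Mℕ.p X ℕ.* m ℕ.+ Mℕ.q X ℕ.* n) , + (Mℕ.r X ℕ.* m ℕ.+ Mℕ.s X ℕ.* n))
  toℤ-⊳-nonneg (matℕ p q r s) m n = cong₂ _,_ (combination p q) (combination r s)
    where
    combination : ∀ p q → + p * + m + + q * + n ≡ + (p ℕ.* m ℕ.+ q ℕ.* n)
    combination p q = trans (cong₂ _+_ (sym (pos-* p m)) (sym (pos-* q n))) (sym (pos-+ (p ℕ.* m) (q ℕ.* n)))

  ⊳-neg : ∀ A x y → A ⊳ (- x , - y) ≡ (- proj₁ (A ⊳ (x , y)) , - proj₂ (A ⊳ (x , y)))
  ⊳-neg (mat a b c d) x y = cong₂ _,_ (combination a b x y) (combination c d x y)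
    where
    combination : ∀ a b x y → a * (- x) + b * (- y) ≡ - (a * x + b * y)
    combination = solve-∀

  ⊳-SignCoherent : ∀ X v → SignCoherent v → SignCoherent (toℤ X ⊳ v)
  ⊳-SignCoherent X v coherent-v with SignCoherent-view v coherent-v
  ... | inj₁ (m , n , refl) = subst SignCoherent (sym (toℤ-⊳-nonneg X m n)) (SignCoherent-nonneg _ _)
  ... | inj₂ (m , n , refl) = subst SignCoherent (sym image≡) (SignCoherent-nonpos _ _)
    where
    image≡ : toℤ X ⊳ (- + m , - + n) ≡ (- + (Mℕ.p X ℕ.* m ℕ.+ Mℕ.q X ℕ.* n) , - + (Mℕ.r X ℕ.* m ℕ.+ Mℕ.s X ℕ.* n))
    image≡ = trans (⊳-neg (toℤ X) (+ m) (+ n)) (cong (λ v → (- proj₁ v , - proj₂ v)) (toℤ-⊳-nonneg X m n))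

  data Positive : M₂ → Set where
    positive : ∀ a b c d → Positive (mat +[1+ a ] +[1+ b ] +[1+ c ] +[1+ d ])

  Positive-ᵀ : ∀ {A} → Positive A → Positive (A ᵀ)
  Positive-ᵀ (positive a b c d) = positive a c b d

  Positive-antitranspose : ∀ {A} → Positive A → Positive (antitranspose A)
  Positive-antitranspose (positive a b c d) = positive d b c a

  ⊳-SignCoherent⁺ : ∀ {A} → Positive A → ∀ {v} → SignCoherent v → SignCoherent (A ⊳ v)
  ⊳-SignCoherent⁺ (positive a b c d) {v} = ⊳-SignCoherent (matℕ (suc a) (suc b) (suc c) (suc d)) v

  μ : ℤ × ℤ → ℕ
  μ (x , y) = ∣ x - y ∣

  weighted-difference : ∀ a b c d x y →
    (c + d) * (a * x + b * y) - (a + b) * (c * x + d * y) ≡ (a * d - b * c) * (x - y)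
  weighted-difference = solve-∀

  mixed<weighted : ∀ a b c d {u} → Mixed u → μ u < ∣ (+[1+ c ] + +[1+ d ]) * proj₁ u - (+[1+ a ] + +[1+ b ]) * proj₂ u ∣
  mixed<weighted a b c d (+- m n) = sum<weighted-sum c d a b m n
  -- In this case both sides normalise to the shape suc (suc (x + y)) instead of suc x + suc y.
  mixed<weighted a b c d (-+ m n) =
    subst₂ _<_ (cong suc (+-suc m n)) (cong suc (+-suc (m ℕ.+ (c ℕ.+ suc d) ℕ.* suc m) (n ℕ.+ (a ℕ.+ suc b) ℕ.* suc n)))
           (sum<weighted-sum c d a b m n)

  -- For A of determinant 1, weighted-difference recovers x − y from (x′, y′) = A (x , y); as the entries of A
  -- are at least 1, this weighted difference exceeds |x′ − y′| = |x′| + |y′| when x′, y′ have opposite signs.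
  mixed-shrinks : ∀ {A} → Positive A → SL A → ∀ v → Mixed (A ⊳ v) → μ (A ⊳ v) < μ v
  mixed-shrinks (positive a b c d) det≡1 (x , y) mixed =
    subst (μ (mat +[1+ a ] +[1+ b ] +[1+ c ] +[1+ d ] ⊳ (x , y)) <_) (cong ∣_∣ weighted≡x-y) (mixed<weighted a b c d mixed)
    where
    weighted≡x-y : (+[1+ c ] + +[1+ d ]) * (+[1+ a ] * x + +[1+ b ] * y) - (+[1+ a ] + +[1+ b ]) * (+[1+ c ] * x + +[1+ d ] * y)
                 ≡ x - y
    weighted≡x-y = trans (weighted-difference +[1+ a ] +[1+ b ] +[1+ c ] +[1+ d ] x y)
                         (trans (cong (_* (x - y)) det≡1) (*-identityˡ (x - y)))

  iterate-+ : ∀ {A : Set} (f : A → A) x m n → iterate f x (m ℕ.+ n) ≡ iterate f (iterate f x m) n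
  iterate-+ f x zero n = refl
  iterate-+ f x (suc m) n = iterate-+ f (f x) m n

  iterate-preserves : ∀ {A : Set} (P : A → Set) (f : A → A) → (∀ {x} → P x → P (f x)) → ∀ {x} n → P x → P (iterate f x n)
  iterate-preserves P f preserves zero Px = Px
  iterate-preserves P f preserves (suc n) Px = iterate-preserves P f preserves n (preserves Px)

  eventually-SignCoherent : ∀ {A} → Positive A → SL A → ∀ v → ∃[ k ] SignCoherent (iterate (A ⊳_) v k)
  eventually-SignCoherent {A} positive-A det≡1 v =
    let k , coherent = after-one-step v (<-wellFounded (μ v)) in suc k , coherent
    where
    after-one-step : ∀ v → Acc _<_ (μ v) → ∃[ k ] SignCoherent (iterate (A ⊳_) (A ⊳ v) k)
    after-one-step v (acc smaller) with signCoherent⊎mixed (A ⊳ v)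
    ... | inj₁ coherent = 0 , coherent
    ... | inj₂ mixed =
      let k , coherent = after-one-step (A ⊳ v) (smaller (mixed-shrinks positive-A det≡1 v mixed)) in suc k , coherent

  col₁ col₂ : M₂ → ℤ × ℤ
  col₁ (mat a b c d) = (a , c)
  col₂ (mat a b c d) = (b , d)

  SignCoherentColumns : M₂ → Set
  SignCoherentColumns Q = SignCoherent (col₁ Q) × SignCoherent (col₂ Q)

  col₁-iterate : ∀ A Q k → col₁ (iterate (A ·_) Q k) ≡ iterate (A ⊳_) (col₁ Q) k
  col₁-iterate A Q zero = refl
  col₁-iterate A Q (suc k) = col₁-iterate A (A · Q) k

  col₂-iterate : ∀ A Q k → col₂ (iterate (A ·_) Q k) ≡ iterate (A ⊳_) (col₂ Q) k
  col₂-iterate A Q zero = refl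
  col₂-iterate A Q (suc k) = col₂-iterate A (A · Q) k

  ·-SignCoherentColumns : ∀ {A} → Positive A → ∀ {Q} → SignCoherentColumns Q → SignCoherentColumns (A · Q)
  ·-SignCoherentColumns positive-A (coherent₁ , coherent₂) = ⊳-SignCoherent⁺ positive-A coherent₁ , ⊳-SignCoherent⁺ positive-A coherent₂

  eventually-SignCoherentColumns : ∀ {A} → Positive A → SL A → ∀ Q → ∃[ k ] SignCoherentColumns (iterate (A ·_) Q k)
  eventually-SignCoherentColumns {A} positive-A det≡1 Q =
    let k₁ , coherent₁ = eventually-SignCoherent positive-A det≡1 (col₁ Q)
        k₂ , coherent₂ = eventually-SignCoherent positive-A det≡1 (col₂ Q)
    in k₁ ℕ.+ k₂ ,
       subst SignCoherent (sym (trans (col₁-iterate A Q (k₁ ℕ.+ k₂)) (iterate-+ (A ⊳_) (col₁ Q) k₁ k₂)))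
         (iterate-preserves SignCoherent (A ⊳_) (⊳-SignCoherent⁺ positive-A) k₂ coherent₁) ,
       subst SignCoherent (sym (trans (col₂-iterate A Q (k₁ ℕ.+ k₂)) (trans (cong (iterate (A ⊳_) (col₂ Q)) (+-comm k₁ k₂)) (iterate-+ (A ⊳_) (col₂ Q) k₂ k₁))))
         (iterate-preserves SignCoherent (A ⊳_) (⊳-SignCoherent⁺ positive-A) k₁ coherent₂)

module Intertwiners where
  open Matrices
  open NonnegativeMatrices
  open SignCoherence
  open import Data.Nat using (ℕ; zero; suc)
  open import Data.Nat.GeneralisedArithmetic using (iterate)
  open import Data.Integer using (+_; -_; +[1+_]; -[1+_]; _+_; _-_; _*_)
  import Data.Integer.Properties as ℤ
  open import Data.Integer.Tactic.RingSolver using (solve-∀)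
  open import Data.Product using (_,_; ∃-syntax; ∃₂)
  open import Data.Sum using (_⊎_; inj₁; inj₂)
  open import Data.Empty using (⊥-elim)
  open import Relation.Nullary using (¬_)
  open import Relation.Binary.PropositionalEquality using (_≡_; refl; sym; trans; cong; subst)

  ᵀ-iterate : ∀ W Q k → (iterate (_· W) Q k) ᵀ ≡ iterate (W ᵀ ·_) (Q ᵀ) k
  ᵀ-iterate W Q zero = refl
  ᵀ-iterate W Q (suc k) = trans (ᵀ-iterate W (Q · W) k) (cong (λ X → iterate (W ᵀ ·_) X k) (ᵀ-· Q W))

  Intertwines : M₂ → M₂ → M₂ → Set
  Intertwines Q W R = Q · W ≡ R · Q

  module _ {W R : M₂} where

    ·ˡ-Intertwines : ∀ {Q} → Intertwines Q W R → Intertwines (R · Q) W R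
    ·ˡ-Intertwines {Q} QW≡RQ = trans (·-assoc R Q W) (cong (R ·_) QW≡RQ)

    ·ʳ-Intertwines : ∀ {Q} → Intertwines Q W R → Intertwines (Q · W) W R
    ·ʳ-Intertwines {Q} QW≡RQ = trans (cong (_· W) QW≡RQ) (·-assoc R Q W)

    neg-Intertwines : ∀ {Q} → Intertwines Q W R → Intertwines (neg Q) W R
    neg-Intertwines {Q} QW≡RQ = trans (neg-·ˡ Q W) (trans (cong neg QW≡RQ) (sym (neg-·ʳ R Q)))

    ≈±-Intertwines : ∀ {Q Q′} → Q ≈± Q′ → Intertwines Q W R → Intertwines Q′ W R
    ≈±-Intertwines (inj₁ refl) QW≡RQ = QW≡RQ
    ≈±-Intertwines {Q} {Q′} (inj₂ Q≡-Q′) QW≡RQ =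
      subst (λ X → Intertwines X W R) (trans (cong neg Q≡-Q′) (neg-involutive Q′)) (neg-Intertwines QW≡RQ)

    iterate-·ʳ≡iterate-·ˡ : ∀ {Q} → Intertwines Q W R → ∀ k → iterate (_· W) Q k ≡ iterate (R ·_) Q k
    iterate-·ʳ≡iterate-·ˡ QW≡RQ zero = refl
    iterate-·ʳ≡iterate-·ˡ {Q} QW≡RQ (suc k) =
      trans (iterate-·ʳ≡iterate-·ˡ (·ʳ-Intertwines QW≡RQ) k) (cong (λ X → iterate (R ·_) X k) QW≡RQ)

  antidiagonal : ℕ → ℕ → M₂
  antidiagonal m n = mat (+ 0) +[1+ m ] -[1+ n ] (+ 0)

  SL-SignCoherent⁺ : ∀ i b c d → SL (mat +[1+ i ] b c d) →
    SignCoherentColumns (mat +[1+ i ] b c d) → SignCoherentColumns (mat +[1+ i ] b c d ᵀ) → ∃[ X ] mat +[1+ i ] b c d ≡ toℤ X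
  SL-SignCoherent⁺ i (+ j) (+ k) (+ l) _ _ _ = matℕ (suc i) j k l , refl
  SL-SignCoherent⁺ i -[1+ _ ] c d _ _ (() , _)
  SL-SignCoherent⁺ i (+ j) -[1+ _ ] d _ (() , _) _
  SL-SignCoherent⁺ i (+ zero) (+ zero) -[1+ l ] () _ _
  SL-SignCoherent⁺ i +[1+ j ] (+ k) -[1+ l ] _ (_ , ()) _
  SL-SignCoherent⁺ i (+ zero) +[1+ k ] -[1+ l ] _ _ (_ , ())

  det-first-column-zero : ∀ b d → det (mat (+ 0) b (+ 0) d) ≡ + 0
  det-first-column-zero b d = identity b d
    where
    identity : ∀ b d → + 0 * d - b * + 0 ≡ + 0
    identity = solve-∀

  SL-SignCoherent⁰ : ∀ b c d → SL (mat (+ 0) b c d) →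
    SignCoherentColumns (mat (+ 0) b c d) → SignCoherentColumns (mat (+ 0) b c d ᵀ) → ∃₂ λ m n → mat (+ 0) b c d ≈± antidiagonal m n
  SL-SignCoherent⁰ b (+ zero) d det≡1 _ _ with trans (sym (det-first-column-zero b d)) det≡1
  ... | ()
  SL-SignCoherent⁰ (+ zero) +[1+ k ] d () _ _
  SL-SignCoherent⁰ (+ zero) -[1+ k ] d () _ _
  SL-SignCoherent⁰ +[1+ j ] +[1+ k ] d () _ _
  SL-SignCoherent⁰ -[1+ j ] -[1+ k ] d () _ _
  SL-SignCoherent⁰ +[1+ j ] -[1+ k ] (+ zero) _ _ _ = j , k , inj₁ refl
  SL-SignCoherent⁰ +[1+ j ] -[1+ k ] +[1+ l ] _ _ (_ , ())
  SL-SignCoherent⁰ +[1+ j ] -[1+ k ] -[1+ l ] _ (_ , ()) _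
  SL-SignCoherent⁰ -[1+ j ] +[1+ k ] (+ zero) _ _ _ = j , k , inj₂ refl
  SL-SignCoherent⁰ -[1+ j ] +[1+ k ] +[1+ l ] _ (_ , ()) _
  SL-SignCoherent⁰ -[1+ j ] +[1+ k ] -[1+ l ] _ _ (_ , ())

  SL-SignCoherent : ∀ Q → SL Q → SignCoherentColumns Q → SignCoherentColumns (Q ᵀ) →
    (∃[ X ] Q ≈± toℤ X) ⊎ (∃₂ λ m n → Q ≈± antidiagonal m n)
  SL-SignCoherent (mat +[1+ i ] b c d) det≡1 columns rows =
    let X , Q≡X = SL-SignCoherent⁺ i b c d det≡1 columns rows in inj₁ (X , inj₁ Q≡X)
  SL-SignCoherent (mat (+ zero) b c d) det≡1 columns rows = inj₂ (SL-SignCoherent⁰ b c d det≡1 columns rows)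
  SL-SignCoherent Q@(mat -[1+ i ] b c d) det≡1 (column₁ , column₂) (row₁ , row₂) =
    let X , -Q≡X = SL-SignCoherent⁺ i (- b) (- c) (- d) (trans (det-neg Q) det≡1)
                     (SignCoherent-neg column₁ , SignCoherent-neg column₂) (SignCoherent-neg row₁ , SignCoherent-neg row₂)
    in inj₁ (X , inj₂ (trans (sym (neg-involutive Q)) (cong neg -Q≡X)))

  -- The top-left entries of Q W and R Q have opposite signs.
  antidiagonal-¬Intertwines : ∀ {W R} → Positive W → Positive R → ∀ m n → ¬ Intertwines (antidiagonal m n) W R
  antidiagonal-¬Intertwines (positive _ _ _ _) (positive a′ b′ _ _) m n QW≡RQ
    with trans (cong M₂.a QW≡RQ) (cong (_+ (+[1+ b′ ] * -[1+ n ])) (ℤ.*-zeroʳ +[1+ a′ ]))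
  ... | ()

  iterate-·ˡ-SL-Intertwines : ∀ W R M → SL R → SL M → Intertwines M W R →
    ∀ k → SL (iterate (R ·_) M k) × Intertwines (iterate (R ·_) M k) W R
  iterate-·ˡ-SL-Intertwines W R M det-R det-M MW≡RM k =
    iterate-preserves (λ X → SL X × Intertwines X W R) (R ·_)
      (λ {X} (det-X , XW≡RX) → SL-· R X det-R det-X , ·ˡ-Intertwines {W} {R} XW≡RX) k (det-M , MW≡RM)

  SignCoherentColumns-Intertwines : ∀ W R M → Positive R → SL R → SL M → Intertwines M W R →
    ∃[ Q ] SL Q × Intertwines Q W R × SignCoherentColumns Q
  SignCoherentColumns-Intertwines W R M positive-R det-R det-M MW≡RM =
    let k , columns = eventually-SignCoherentColumns positive-R det-R M
        det-Q , QW≡RQ = iterate-·ˡ-SL-Intertwines W R M det-R det-M MW≡RM k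
    in iterate (R ·_) M k , det-Q , QW≡RQ , columns

  -- On an intertwiner, multiplying by powers of R on the left is the same as multiplying by powers
  -- of W on the right, which makes the rows sign-coherent while keeping the columns so.
  SignCoherent-Intertwines : ∀ W R M → Positive W → Positive R → SL W → SL R → SL M → Intertwines M W R →
    ∃[ Q ] SL Q × Intertwines Q W R × SignCoherentColumns Q × SignCoherentColumns (Q ᵀ)
  SignCoherent-Intertwines W R M positive-W positive-R det-W det-R det-M MW≡RM =
    let Q , det-Q , QW≡RQ , columns = SignCoherentColumns-Intertwines W R M positive-R det-R det-M MW≡RM
        j , rows = eventually-SignCoherentColumns (Positive-ᵀ positive-W) (SL-ᵀ W det-W) (Q ᵀ)
        det-Q′ , Q′W≡RQ′ = iterate-·ˡ-SL-Intertwines W R Q det-R det-Q QW≡RQ j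
    in iterate (R ·_) Q j , det-Q′ , Q′W≡RQ′ ,
       iterate-preserves SignCoherentColumns (R ·_) (·-SignCoherentColumns positive-R) j columns ,
       subst SignCoherentColumns (trans (sym (ᵀ-iterate W Q j)) (cong _ᵀ (iterate-·ʳ≡iterate-·ˡ {W} {R} {Q} QW≡RQ j))) rows

  nonnegative-Intertwines : ∀ W R M → Positive W → Positive R → SL W → SL R → SL M → Intertwines M W R →
    ∃[ X ] Unimodular X × Intertwines (toℤ X) W R
  nonnegative-Intertwines W R M positive-W positive-R det-W det-R det-M MW≡RM =
    let Q , det-Q , QW≡RQ , columns , rows = SignCoherent-Intertwines W R M positive-W positive-R det-W det-R det-M MW≡RM
    in by-shape Q det-Q QW≡RQ (SL-SignCoherent Q det-Q columns rows)
    where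
    by-shape : ∀ Q → SL Q → Intertwines Q W R → (∃[ X ] Q ≈± toℤ X) ⊎ (∃₂ λ m n → Q ≈± antidiagonal m n) →
      ∃[ X ] Unimodular X × Intertwines (toℤ X) W R
    by-shape Q det-Q QW≡RQ (inj₁ (X , Q≈X)) =
      X , SL-toℤ⇒Unimodular X (≈±-SL Q≈X det-Q) , ≈±-Intertwines {W} {R} Q≈X QW≡RQ
    by-shape Q det-Q QW≡RQ (inj₂ (m , n , Q≈antidiagonal)) =
      ⊥-elim (antidiagonal-¬Intertwines positive-W positive-R m n (≈±-Intertwines {W} {R} Q≈antidiagonal QW≡RQ))

module Ambiguity where
  open Rotations
  open Matrices
  open NonnegativeMatrices
  open SignCoherence
  open Intertwiners
  open import Data.Nat using (zero; suc; s≤s)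
  import Data.Nat as ℕ
  open import Data.Nat.Properties using (*-zeroʳ; m*n≡1⇒m≡1; m*n≡1⇒n≡1)
  open import Data.Integer using (+_; -_; _*_; ∣_∣)
  open import Data.Integer.Properties using (∣-i∣≡∣i∣)
  open import Data.List using (_++_; reverse; take; drop)
  open import Data.List.Properties using (take++drop≡id)
  open import Data.Product using (_,_; ∃-syntax)
  open import Data.Sum using (inj₁; inj₂)
  open import Data.Empty using (⊥-elim)
  open import Relation.Binary.PropositionalEquality using (_≡_; _≢_; refl; sym; trans; cong; cong₂; subst; module ≡-Reasoning)
  import Relation.Binary.Reasoning.Setoid as SetoidReasoning

  inv-evalWord : ∀ w → inv (evalWord w) ≡ conj J (evalWord (reverse w))
  inv-evalWord w = trans (inv≡conj-J-antitranspose (evalWord w) (evalWord-SL w)) (cong (conj J) (sym (evalWord-reverse w)))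

  cyclicPalindrome⇒ambiguous : ∀ w g → g ≈± evalWord w → CyclicPalindrome w → Ambiguous g
  cyclicPalindrome⇒ambiguous w g g≈W (i , v++u≡w) = J · T , det-JT , I₂ , refl , (begin
    conj I₂ (conj (J · T) g)          ≡⟨ conj-identity (conj (J · T) g) ⟩
    conj (J · T) g                    ≈⟨ conj-cong (J · T) g≈W ⟩
    conj (J · T) (evalWord w)         ≡⟨ cong (conj (J · T)) W≡DT ⟩
    conj (J · T) (D · T)              ≡⟨ conj-· J T (D · T) ⟩
    conj J (conj T (D · T))           ≡⟨ cong (conj J) (intertwines⇒conj≡ T (D · T) (T · D) (evalWord-SL u) (sym (·-assoc T D T))) ⟩
    conj J (T · D)                    ≡⟨ cong (conj J) R≡TD ⟨
    conj J (evalWord (reverse w))     ≡⟨ inv-evalWord w ⟨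
    inv (evalWord w)                  ≈⟨ inv-cong g≈W ⟨
    inv g                             ∎)
    where
    open SetoidReasoning ≈±-setoid
    u v : List Letter
    u = take i (reverse w)
    v = drop i (reverse w)
    T D : M₂
    T = evalWord u
    D = evalWord v
    W≡DT : evalWord w ≡ D · T
    W≡DT = trans (cong evalWord (sym v++u≡w)) (evalWord-++ v u)
    R≡TD : evalWord (reverse w) ≡ T · D
    R≡TD = trans (cong evalWord (sym (take++drop≡id i (reverse w)))) (evalWord-++ u v)
    det-JT : det (J · T) ≡ - + 1
    det-JT = trans (det-· J T) (cong (det J *_) (evalWord-SL u))

  ambiguous⇒conj≈reverse : ∀ w g → g ≈± evalWord w → Ambiguous g →
    ∃[ M ] SL M × conj M (evalWord w) ≈± evalWord (reverse w)
  ambiguous⇒conj≈reverse w g g≈W (Q , det-Q , P , det-P , conj≈inv) = J · (P · Q) , det-M , (begin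
    conj (J · (P · Q)) W              ≡⟨ conj-· J (P · Q) W ⟩
    conj J (conj (P · Q) W)           ≡⟨ cong (conj J) (conj-· P Q W) ⟩
    conj J (conj P (conj Q W))        ≈⟨ conj-cong J (conj-cong P (conj-cong Q g≈W)) ⟨
    conj J (conj P (conj Q g))        ≈⟨ conj-cong J conj≈inv ⟩
    conj J (inv g)                    ≈⟨ conj-cong J (inv-cong g≈W) ⟩
    conj J (inv W)                    ≡⟨ cong (conj J) (inv-evalWord w) ⟩
    conj J (conj J R)                 ≡⟨ conj-J-involutive R ⟩
    R                                 ∎)
    where
    open SetoidReasoning ≈±-setoid
    W R : M₂
    W = evalWord w
    R = evalWord (reverse w)
    det-M : SL (J · (P · Q))
    det-M = trans (det-· J (P · Q)) (cong (det J *_) (trans (det-· P Q) (cong₂ _*_ det-P det-Q)))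

  tr-Positive≢tr-neg-Positive : ∀ {A B} → Positive A → Positive B → tr A ≢ tr (neg B)
  tr-Positive≢tr-neg-Positive (positive _ _ _ _) (positive _ _ _ _) ()

  conj≈±⇒conj≡ : ∀ M W R → SL M → Positive W → Positive R → conj M W ≈± R → conj M W ≡ R
  conj≈±⇒conj≡ M W R det-M positive-W positive-R (inj₁ MWM⁻¹≡R) = MWM⁻¹≡R
  conj≈±⇒conj≡ M W R det-M positive-W positive-R (inj₂ MWM⁻¹≡-R) =
    ⊥-elim (tr-Positive≢tr-neg-Positive positive-W positive-R (trans (sym (tr-conj M W det-M)) (cong tr MWM⁻¹≡-R)))

  ∣tr∣-≈± : ∀ {A B} → A ≈± B → ∣ tr A ∣ ≡ ∣ tr B ∣
  ∣tr∣-≈± (inj₁ refl) = refl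
  ∣tr∣-≈± {B = B} (inj₂ refl) = trans (cong ∣_∣ (tr-neg B)) (∣-i∣≡∣i∣ (tr B))

  -- A zero entry forces p s = 1, hence trace 2.
  Hyperbolic-Unimodular⇒Positive : ∀ X → Unimodular X → Hyperbolic (toℤ X) → Positive (toℤ X)
  Hyperbolic-Unimodular⇒Positive (matℕ (suc p) (suc q) (suc r) (suc s)) _ _ = positive p q r s
  Hyperbolic-Unimodular⇒Positive (matℕ zero q r s) () _
  Hyperbolic-Unimodular⇒Positive (matℕ (suc p) q r zero) unimodular _ with trans (sym (*-zeroʳ (suc p))) unimodular
  ... | ()
  Hyperbolic-Unimodular⇒Positive (matℕ (suc p) zero r (suc s)) unimodular hyperbolic
    with m*n≡1⇒m≡1 (suc p) (suc s) unimodular | m*n≡1⇒n≡1 (suc p) (suc s) unimodular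
  ... | refl | refl with hyperbolic
  ... | s≤s (s≤s ())
  Hyperbolic-Unimodular⇒Positive (matℕ (suc p) (suc q) zero (suc s)) unimodular hyperbolic
    with trans unimodular (cong suc (*-zeroʳ (suc q)))
  ... | ps≡1 with m*n≡1⇒m≡1 (suc p) (suc s) ps≡1 | m*n≡1⇒n≡1 (suc p) (suc s) ps≡1
  ... | refl | refl with hyperbolic
  ... | s≤s (s≤s ())

  evalWord-Positive : ∀ w → Hyperbolic (evalWord w) → Positive (evalWord w)
  evalWord-Positive w hyperbolic =
    subst Positive (sym W≡X) (Hyperbolic-Unimodular⇒Positive (evalℕ w) (evalℕ-unimodular w) (subst Hyperbolic W≡X hyperbolic))
    where
    W≡X : evalWord w ≡ toℤ (evalℕ w)
    W≡X = evalWord≡toℤ-evalℕ w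

  Intertwines-evalWord⇒rotation : ∀ q w r → Intertwines (evalWord q) (evalWord w) (evalWord r) → ∃[ i ] rotate i r ≡ w
  Intertwines-evalWord⇒rotation q w r qw≡rq = conjugate⇒rotation q w r (evalWord-injective (q ++ w) (r ++ q) (begin
    evalWord (q ++ w)                 ≡⟨ evalWord-++ q w ⟩
    evalWord q · evalWord w           ≡⟨ qw≡rq ⟩
    evalWord r · evalWord q           ≡⟨ evalWord-++ r q ⟨
    evalWord (r ++ q)                 ∎))
    where open ≡-Reasoning

  positive-Intertwines⇒rotation : ∀ w r M → Positive (evalWord w) → Positive (evalWord r) → SL M →
    Intertwines M (evalWord w) (evalWord r) → ∃[ i ] rotate i r ≡ w
  positive-Intertwines⇒rotation w r M positive-W positive-R det-M MW≡RM =
    let X , unimodular , XW≡RX = nonnegative-Intertwines (evalWord w) (evalWord r) M positive-W positive-R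
                                   (evalWord-SL w) (evalWord-SL r) det-M MW≡RM
        q , evalℕq≡X = evalℕ-surjective X unimodular
        Q≡X = trans (evalWord≡toℤ-evalℕ q) (cong toℤ evalℕq≡X)
    in Intertwines-evalWord⇒rotation q w r (subst (λ Y → Intertwines Y (evalWord w) (evalWord r)) (sym Q≡X) XW≡RX)

  ambiguous⇒cyclicPalindrome : ∀ w g → g ≈± evalWord w → Hyperbolic g → Ambiguous g → CyclicPalindrome w
  ambiguous⇒cyclicPalindrome w g g≈W hyperbolic ambiguous =
    let M , det-M , MWM⁻¹≈R = ambiguous⇒conj≈reverse w g g≈W ambiguous
        positive-W = evalWord-Positive w (subst (2 ℕ.<_) (∣tr∣-≈± g≈W) hyperbolic)
        positive-R = subst Positive (sym (evalWord-reverse w)) (Positive-antitranspose positive-W)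
        MWM⁻¹≡R = conj≈±⇒conj≡ M (evalWord w) (evalWord (reverse w)) det-M positive-W positive-R MWM⁻¹≈R
    in positive-Intertwines⇒rotation w (reverse w) M positive-W positive-R det-M
         (conj≡⇒intertwines M (evalWord w) (evalWord (reverse w)) det-M MWM⁻¹≡R)

open Ambiguity using (cyclicPalindrome⇒ambiguous; ambiguous⇒cyclicPalindrome)

proposition1p9 : (es : List (ℕ × ℕ)) → ValidExps es → (g : M₂) → SL g →
    g ≈± evalWord (UVword es) → Hyperbolic g →
    (CyclicPalindrome (UVword es) ⇔ Ambiguous g)
proposition1p9 es _ g _ g≈W hyperbolic =
  mk⇔ (cyclicPalindrome⇒ambiguous (UVword es) g g≈W) (ambiguous⇒cyclicPalindrome (UVword es) g g≈W hyperbolic)
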